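{- For an integer $g$, let $P_{4,g} = \{(x,y,z)\in\mathbb{R}^3: 2x-y\ge 0,\ x+y-z \ge 0,\ -x+y+z \ge -1,\ -y + 2z \ge -1,\ x+y+z=g,\ x\ge 1,\ y \ge 1,\ z\ge 1\}$. Then: (i) $\#(P_{4,g} \cap \mathbb{Z}^3)$ equals $1,3,4,6,7,9$ for $g=3,4,5,6,7,8$ respectively; (ii) if $g\ge 9$, then $\#(P_{4,g} \cap \mathbb{Z}^3)= \#(T_A(g) \cap \mathbb{Z}^2) + \#(T_B(g) \cap \mathbb{Z}^2) + \#(R(g) \cap \mathbb{Z}^2) - \#(T_C(g) \cap \mathbb{Z}^2)$, where $T_A(g) = \{ (x,y) \in \mathbb{R}^2: 3x+y \ge g,\ x\le \frac{2g+1}{8},\ y \le \frac{g}{2}\}$, $T_B(g) = \{ (x,y) \in \mathbb{R}^2: x+3y \ge g-1,\ x\le \frac{g+1}{2},\ y \le \frac{2g-3}{8}\}$, $R(g) = \{ (x,y) \in \mathbb{R}^2: \frac{2g+1}{8} \le x\le \frac{g+1}{2},\ \frac{2g-3}{8} \le y \le \frac{g}{2}\}$, and $T_C(g) = \{ (x,y) \in \mathbb{R}^2: x+y \ge g,\ x \le \frac{g+1}{2},\ y \le \frac{g}{2}\}$. -}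

module Defs where

open import Data.Integer using (ℤ; +_; _+_; _-_; _*_; -_; _≤_)
open import Data.Product using (Σ; _×_; _,_)
open import Data.Nat using (ℕ)
open import Data.Fin using (Fin)
open import Function.Bundles using (_↔_)

-- Rational bounds such as x ≤ (2g+1)/8 are written with denominators
-- cleared (8x ≤ 2g+1), which is equivalent for real (hence integer) x.

P4 : ℤ → ℤ × ℤ × ℤ → Set
P4 g (x , y , z) =
  (+ 0 ≤ + 2 * x - y) × (+ 0 ≤ x + y - z) × (- + 1 ≤ - x + y + z) ×
  (- + 1 ≤ - y + + 2 * z) × (x + y + z ≡ g) ×
  (+ 1 ≤ x) × (+ 1 ≤ y) × (+ 1 ≤ z)
  where open import Relation.Binary.PropositionalEquality using (_≡_)

TA : ℤ → ℤ × ℤ → Set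
TA g (x , y) = (g ≤ + 3 * x + y) × (+ 8 * x ≤ + 2 * g + + 1) × (+ 2 * y ≤ g)

TB : ℤ → ℤ × ℤ → Set
TB g (x , y) = (g - + 1 ≤ x + + 3 * y) × (+ 2 * x ≤ g + + 1) × (+ 8 * y ≤ + 2 * g - + 3)

RR : ℤ → ℤ × ℤ → Set
RR g (x , y) = (+ 2 * g + + 1 ≤ + 8 * x) × (+ 2 * x ≤ g + + 1) ×
               (+ 2 * g - + 3 ≤ + 8 * y) × (+ 2 * y ≤ g)

TC : ℤ → ℤ × ℤ → Set
TC g (x , y) = (g ≤ x + y) × (+ 2 * x ≤ g + + 1) × (+ 2 * y ≤ g)

HasCard : {A : Set} → (A → Set) → ℕ → Set
HasCard {A} S n = Fin n ↔ Σ A S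

-- Solving x + y + z = g for y identifies the integer points of P_{4,g} with
-- those of a polygon P in the (x, z)-plane; the planar regions T_A, T_B, R,
-- T_C live in the same plane. For g ≥ 9 their integer points satisfy
--
--   P ⊎ T_C = T_A ⊎ T_B ⊎ R   (both unions disjoint):
--
-- a point of P lies in T_A, T_B or R according to whether 8x ≤ 2g + 1 and
-- 8z ≤ 2g − 3, T_C lies inside R, and a point of T_A, T_B or R lies in P or in
-- T_C according to whether x + z < g. Each of these implications between
-- linear conditions is a nonnegative integer combination of the hypotheses,
-- followed where needed by a rounding step that is valid only for integers,
-- and is checked by computing with coefficients. All regions lie in the box
-- [0, g]², so the decomposition becomes an identity between the sizes of
-- filtered sublists of the box; for 3 ≤ g ≤ 8 these sizes are simply evaluated.

module Submission where

open import Defs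

open import Axiom.UniquenessOfIdentityProofs using (UIP; module Decidable⇒UIP)
open import Data.Fin using (Fin; zero; suc)
open import Data.Integer using (ℤ; +_; _+_; -[1+_]; -_; _-_; _*_; _≤_; _<_; +≤+; -≤-; +<+)
open import Data.Integer.Properties as ℤ
  using (_≟_; _≤?_; ≤-irrelevant; ≤-trans; +-monoˡ-≤; +-mono-≤; *-monoˡ-≤-nonNeg; *-zeroʳ;
         +-identityʳ; +-injective; i≤j⇒0≤j-i; 0≤i-j⇒j≤i; ≰⇒>)
open import Data.Integer.Tactic.RingSolver using (solve-∀)
open import Data.List using (List; []; _∷_; length; filter; lookup; map; upTo; cartesianProduct)
open import Data.List.Membership.Propositional using (_∈_)
open import Data.List.Membership.Propositional.Properties
  using (∈-filter⁺; ∈-filter⁻; ∈-lookup; ∈-map⁺; ∈-upTo⁺; ∈-cartesianProduct⁺)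
open import Data.List.Membership.Setoid.Properties using (unique⇒irrelevant)
open import Data.List.Properties using (filter-≐)
open import Data.List.Relation.Unary.Any using (here; there; index)
open import Data.List.Relation.Unary.Unique.Propositional using (Unique)
open import Data.List.Relation.Unary.Unique.Propositional.Properties
  using (filter⁺; map⁺; upTo⁺; cartesianProduct⁺)
open import Data.Nat as ℕ using (ℕ; z≤n; s≤s; NonZero)
open import Data.Nat.Properties using (+-suc; +-assoc)
open import Data.Product using (Σ; ∃; _×_; _,_; proj₁; proj₂; map₂)
open import Data.Product.Function.NonDependent.Propositional using (_×-⇔_)
open import Data.Product.Properties using (≡-dec)
open import Data.Sum using (_⊎_; inj₁; inj₂)
open import Data.Unit using (⊤; tt)
open import Function using (_∘_)
open import Function.Bundles using (_↔_; _⇔_; mk↔ₛ′; mk⇔; Equivalence)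
open import Function.Construct.Composition using (_↔-∘_)
open import Function.Construct.Identity using (⇔-id)
open import Function.Construct.Symmetry using (↔-sym)
open import Level using (0ℓ)
open import Relation.Binary.PropositionalEquality
  using (_≡_; refl; sym; trans; cong; cong₂; subst; subst₂; setoid; module ≡-Reasoning)
open import Relation.Nullary using (¬_; Dec; yes; no; contradiction)
open import Relation.Nullary.Decidable using (True; toWitness; _×-dec_; map′)
import Relation.Nullary.Irrelevant as Nullary
open import Relation.Unary using (Pred; Decidable; Irrelevant; _⊆_; _∪_; _⊥_; _≐_)
open import Relation.Unary.Properties using (_∪?_)

private variable
  X Y : Set
  n : ℕ

-- Finite cardinalities

infixr 2 _×-irrelevant_

_×-irrelevant_ : Nullary.Irrelevant X → Nullary.Irrelevant Y → Nullary.Irrelevant (X × Y)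
(X-irr ×-irrelevant Y-irr) (x , y) (x′ , y′) = cong₂ _,_ (X-irr x x′) (Y-irr y y′)

Σ-⇔ : {P Q : Pred X 0ℓ} → Irrelevant P → Irrelevant Q → (∀ {x} → P x ⇔ Q x) → Σ X P ↔ Σ X Q
Σ-⇔ P-irr Q-irr P⇔Q = mk↔ₛ′
  (λ (x , p) → x , Equivalence.to P⇔Q p) (λ (x , q) → x , Equivalence.from P⇔Q q)
  (λ (x , q) → cong (x ,_) (Q-irr _ q)) (λ (x , p) → cong (x ,_) (P-irr _ p))

Σ-eliminate-middle : {Z : Set} {S : Pred (X × Y × Z) 0ℓ} (f : X → Z → Y) → Irrelevant S →
                     (∀ {x y z} → S (x , y , z) → y ≡ f x z) →
                     Σ (X × Y × Z) S ↔ Σ (X × Z) (λ (x , z) → S (x , f x z , z))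
Σ-eliminate-middle {S = S} f S-irr on-graph = mk↔ₛ′
  (λ ((x , y , z) , s) → (x , z) , subst (λ y → S (x , y , z)) (on-graph s) s)
  (λ ((x , z) , s) → (x , f x z , z) , s)
  (λ ((x , z) , s) → cong ((x , z) ,_) (S-irr _ s))
  (λ (_ , s) → from-to (on-graph s))
  where
  from-to : ∀ {x y z s} (y≡ : y ≡ f x z) →
            ((x , f x z , z) , subst (λ y → S (x , y , z)) y≡ s) ≡ ((x , y , z) , s)
  from-to refl = refl

HasCard-↔ : {P : Pred X 0ℓ} {Q : Pred Y 0ℓ} → Σ X P ↔ Σ Y Q → HasCard P n → HasCard Q n
HasCard-↔ P↔Q card = P↔Q ↔-∘ card

Fin↔∃∈ : (xs : List X) → Fin (length xs) ↔ ∃ (_∈ xs)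
Fin↔∃∈ xs = mk↔ₛ′ (λ i → lookup xs i , ∈-lookup i) (λ (_ , x∈) → index x∈)
                  (λ (_ , x∈) → lookup-index x∈) index-lookup
  where
  lookup-index : ∀ {xs} {x : X} (x∈ : x ∈ xs) →
                 (lookup xs (index x∈) , ∈-lookup (index x∈)) ≡ (x , x∈)
  lookup-index (here refl) = refl
  lookup-index (there x∈)  = cong (map₂ there) (lookup-index x∈)
  index-lookup : ∀ {xs : List X} i → index (∈-lookup {xs = xs} i) ≡ i
  index-lookup {xs = _ ∷ _} zero    = refl
  index-lookup {xs = _ ∷ _} (suc i) = cong suc (index-lookup i)

HasCard-filter : UIP X → {P : Pred X 0ℓ} (P? : Decidable P) → Irrelevant P →
                 ∀ {xs} → Unique xs → P ⊆ (_∈ xs) → HasCard P (length (filter P? xs))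
HasCard-filter {X = X} uip P? P-irr {xs} xs-unique P⊆xs =
  Σ-⇔ (unique⇒irrelevant (setoid X) uip (filter⁺ P? xs-unique)) P-irr
      (mk⇔ (proj₂ ∘ ∈-filter⁻ P? {xs = xs}) (λ p → ∈-filter⁺ P? (P⊆xs p) p))
  ↔-∘ Fin↔∃∈ (filter P? xs)

length-filter-∪ : {P Q : Pred X 0ℓ} (P? : Decidable P) (Q? : Decidable Q) → P ⊥ Q → ∀ xs →
                  length (filter (P? ∪? Q?) xs) ≡ length (filter P? xs) ℕ.+ length (filter Q? xs)
length-filter-∪ P? Q? P⊥Q [] = refl
length-filter-∪ P? Q? P⊥Q (x ∷ xs) with P? x | Q? x
... | yes p | yes q = contradiction (p , q) P⊥Q
... | yes _ | no _  = cong ℕ.suc (length-filter-∪ P? Q? P⊥Q xs)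
... | no _  | yes _ = trans (cong ℕ.suc (length-filter-∪ P? Q? P⊥Q xs)) (sym (+-suc _ _))
... | no _  | no _  = length-filter-∪ P? Q? P⊥Q xs

-- Linear forms

-- lin c a b d is the affine form c + a·g + b·x + d·z; a point (x, z) satisfies
-- it when the form is nonnegative there. The coordinates x and z are the first
-- and third coordinates of P4 and the two coordinates of TA, TB, RR and TC.
record Form : Set where
  constructor lin
  field
    const gᶜ xᶜ zᶜ : ℤ

⟦_⟧ : Form → ℤ → ℤ × ℤ → ℤ
⟦ lin c a b d ⟧ g (x , z) = c + (a * g + b * x + d * z)

record Holds (L : Form) (g : ℤ) (p : ℤ × ℤ) : Set where
  constructor holds
  field
    nonneg : + 0 ≤ ⟦ L ⟧ g p

infixl 6 _+ᶠ_
infixr 7 _·ᶠ_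

_+ᶠ_ : Form → Form → Form
lin c a b d +ᶠ lin c′ a′ b′ d′ = lin (c + c′) (a + a′) (b + b′) (d + d′)

_·ᶠ_ : ℕ → Form → Form
k ·ᶠ lin c a b d = lin (+ k * c) (+ k * a) (+ k * b) (+ k * d)

constᶠ : ℤ → Form
constᶠ c = lin c (+ 0) (+ 0) (+ 0)

complement : Form → Form
complement (lin c a b d) = lin (- c - + 1) (- a) (- b) (- d)

_≼_ : Form → Form → Set
lin c a b d ≼ lin c′ a′ b′ d′ = a ≡ a′ × b ≡ b′ × d ≡ d′ × c ≤ c′

_≼?_ : ∀ L M → Dec (L ≼ M)
lin c a b d ≼? lin c′ a′ b′ d′ = a ≟ a′ ×-dec b ≟ b′ ×-dec d ≟ d′ ×-dec c ≤? c′

0≤[1+j]*i+j⇒0≤i : ∀ j {i} → + 0 ≤ + ℕ.suc j * i + + j → + 0 ≤ i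
0≤[1+j]*i+j⇒0≤i j {+ _}      _  = +≤+ z≤n
0≤[1+j]*i+j⇒0≤i j { -[1+ m ]} 0≤ = contradiction (≤-trans 0≤ (begin
  + ℕ.suc j * -[1+ m ] + + j ≤⟨ +-monoˡ-≤ (+ j) (*-monoˡ-≤-nonNeg (+ ℕ.suc j) (-≤- z≤n)) ⟩
  (+ 1 + + j) * - + 1 + + j  ≡⟨ [1+j]*-1+j≡-1 (+ j) ⟩
  - + 1                      ∎)) λ ()
  where
  open ℤ.≤-Reasoning
  [1+j]*-1+j≡-1 : ∀ j → (+ 1 + j) * - + 1 + j ≡ - + 1
  [1+j]*-1+j≡-1 = solve-∀

i<0⇒0≤-i-1 : ∀ {i} → i < + 0 → + 0 ≤ - i - + 1
i<0⇒0≤-i-1 {+ _}       (+<+ ())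
i<0⇒0≤-i-1 { -[1+ _ ]} _ = +≤+ z≤n

module _ {g : ℤ} {p : ℤ × ℤ} where

  ⟦+ᶠ⟧ : ∀ L M → ⟦ L +ᶠ M ⟧ g p ≡ ⟦ L ⟧ g p + ⟦ M ⟧ g p
  ⟦+ᶠ⟧ (lin c a b d) (lin c′ a′ b′ d′) = distrib c a b d c′ a′ b′ d′ g (proj₁ p) (proj₂ p)
    where
    distrib : ∀ c a b d c′ a′ b′ d′ g x z →
      c + c′ + ((a + a′) * g + (b + b′) * x + (d + d′) * z) ≡
      c + (a * g + b * x + d * z) + (c′ + (a′ * g + b′ * x + d′ * z))
    distrib = solve-∀

  ⟦·ᶠ⟧ : ∀ k L → ⟦ k ·ᶠ L ⟧ g p ≡ + k * ⟦ L ⟧ g p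
  ⟦·ᶠ⟧ k (lin c a b d) = distrib (+ k) c a b d g (proj₁ p) (proj₂ p)
    where
    distrib : ∀ k c a b d g x z →
      k * c + (k * a * g + k * b * x + k * d * z) ≡ k * (c + (a * g + b * x + d * z))
    distrib = solve-∀

  ⟦complement⟧ : ∀ L → ⟦ complement L ⟧ g p ≡ - ⟦ L ⟧ g p - + 1
  ⟦complement⟧ (lin c a b d) = negate c a b d g (proj₁ p) (proj₂ p)
    where
    negate : ∀ c a b d g x z →
      - c - + 1 + (- a * g + - b * x + - d * z) ≡ - (c + (a * g + b * x + d * z)) - + 1
    negate = solve-∀

  ⟦constᶠ⟧ : ∀ c → ⟦ constᶠ c ⟧ g p ≡ c
  ⟦constᶠ⟧ = +-identityʳ

  ≼⇒≤ : ∀ {L M} → L ≼ M → ⟦ L ⟧ g p ≤ ⟦ M ⟧ g p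
  ≼⇒≤ {lin _ _ _ _} {lin _ _ _ _} (refl , refl , refl , c≤c′) = +-monoˡ-≤ _ c≤c′

  ≤⇔Holds : ∀ {L a b} → b - a ≡ ⟦ L ⟧ g p → a ≤ b ⇔ Holds L g p
  ≤⇔Holds b-a≡L = mk⇔ (λ a≤b → holds (subst (+ 0 ≤_) b-a≡L (i≤j⇒0≤j-i a≤b)))
                      (λ (holds 0≤L) → 0≤i-j⇒j≤i (subst (+ 0 ≤_) (sym b-a≡L) 0≤L))

  Holds? : ∀ L → Dec (Holds L g p)
  Holds? L = map′ holds Holds.nonneg (+ 0 ≤? ⟦ L ⟧ g p)

  Holds-irrelevant : ∀ {L} → Nullary.Irrelevant (Holds L g p)
  Holds-irrelevant (holds h) (holds h′) = cong holds (≤-irrelevant h h′)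

  infixl 6 _⊕_
  infixr 7 _⊛_

  _⊕_ : ∀ {L M} → Holds L g p → Holds M g p → Holds (L +ᶠ M) g p
  _⊕_ {L} {M} (holds 0≤L) (holds 0≤M) = holds (subst (+ 0 ≤_) (sym (⟦+ᶠ⟧ L M)) (+-mono-≤ 0≤L 0≤M))

  _⊛_ : ∀ k {L} → Holds L g p → Holds (k ·ᶠ L) g p
  _⊛_ k {L} (holds 0≤L) =
    holds (subst₂ _≤_ (*-zeroʳ (+ k)) (sym (⟦·ᶠ⟧ k L)) (*-monoˡ-≤-nonNeg (+ k) 0≤L))

  -- Chvátal–Gomory rounding: for an integer e, k·e + (k − 1) ≥ 0 forces e ≥ 0.
  cut : ∀ k {L M} .{{_ : NonZero k}} {_ : True (M ≼? (k ·ᶠ L +ᶠ constᶠ (+ (k ℕ.∸ 1))))} →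
        Holds M g p → Holds L g p
  cut k@(ℕ.suc j) {L} {M} {M≼} (holds 0≤M) = holds (0≤[1+j]*i+j⇒0≤i j (begin
    + 0                                   ≤⟨ 0≤M ⟩
    ⟦ M ⟧ g p                             ≤⟨ ≼⇒≤ (toWitness M≼) ⟩
    ⟦ k ·ᶠ L +ᶠ constᶠ (+ j) ⟧ g p        ≡⟨ ⟦+ᶠ⟧ (k ·ᶠ L) (constᶠ (+ j)) ⟩
    ⟦ k ·ᶠ L ⟧ g p + ⟦ constᶠ (+ j) ⟧ g p ≡⟨ cong₂ _+_ (⟦·ᶠ⟧ k L) (⟦constᶠ⟧ (+ j)) ⟩
    + k * ⟦ L ⟧ g p + + j                 ∎))
    where open ℤ.≤-Reasoning

  Holds⊎Holds-complement : ∀ L → Holds L g p ⊎ Holds (complement L) g p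
  Holds⊎Holds-complement L with Holds? L
  ... | yes L≥0 = inj₁ L≥0
  ... | no L≱0  =
    inj₂ (holds (subst (+ 0 ≤_) (sym (⟦complement⟧ L)) (i<0⇒0≤-i-1 (≰⇒> (L≱0 ∘ holds)))))

  1≰0 : ¬ Holds (constᶠ (- + 1)) g p
  1≰0 (holds ())

-- The regions

module Ineq where
  g≤3x+z g≤x+3z+1 g≤x+z 2x≤g+1 2z≤g 1≤x 1≤z x+z+1≤g 8x≤2g+1 8z≤2g-3 2g+1≤8x 2g-3≤8z : Form
  g≤3x+z   = lin (+ 0) (- + 1) (+ 3) (+ 1)
  g≤x+3z+1 = lin (+ 1) (- + 1) (+ 1) (+ 3)
  g≤x+z    = lin (+ 0) (- + 1) (+ 1) (+ 1)
  2x≤g+1   = lin (+ 1) (+ 1) (- + 2) (+ 0)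
  2z≤g     = lin (+ 0) (+ 1) (+ 0) (- + 2)
  1≤x      = lin (- + 1) (+ 0) (+ 1) (+ 0)
  1≤z      = lin (- + 1) (+ 0) (+ 0) (+ 1)
  x+z+1≤g  = lin (- + 1) (+ 1) (- + 1) (- + 1)
  8x≤2g+1  = lin (+ 1) (+ 2) (- + 8) (+ 0)
  8z≤2g-3  = lin (- + 3) (+ 2) (+ 0) (- + 8)
  2g+1≤8x  = lin (- + 1) (- + 2) (+ 8) (+ 0)
  2g-3≤8z  = lin (+ 3) (- + 2) (+ 0) (+ 8)

  4x≤g 4z+2≤g 0≤x x≤g 0≤z z≤g 9≤g : Form
  4x≤g     = lin (+ 0) (+ 1) (- + 4) (+ 0)
  4z+2≤g   = lin (- + 2) (+ 1) (+ 0) (- + 4)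
  0≤x      = lin (+ 0) (+ 0) (+ 1) (+ 0)
  x≤g      = lin (+ 0) (+ 1) (- + 1) (+ 0)
  0≤z      = lin (+ 0) (+ 0) (+ 0) (+ 1)
  z≤g      = lin (+ 0) (+ 1) (+ 0) (- + 1)
  9≤g      = lin (- + 9) (+ 1) (+ 0) (+ 0)

module _ where
  open Ineq

  P-ineqs TA-ineqs TB-ineqs R-ineqs TC-ineqs Box-ineqs : List Form
  P-ineqs   = g≤3x+z ∷ 2z≤g ∷ 2x≤g+1 ∷ g≤x+3z+1 ∷ 1≤x ∷ x+z+1≤g ∷ 1≤z ∷ []
  TA-ineqs  = g≤3x+z ∷ 8x≤2g+1 ∷ 2z≤g ∷ []
  TB-ineqs  = g≤x+3z+1 ∷ 2x≤g+1 ∷ 8z≤2g-3 ∷ []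
  R-ineqs   = 2g+1≤8x ∷ 2x≤g+1 ∷ 2g-3≤8z ∷ 2z≤g ∷ []
  TC-ineqs  = g≤x+z ∷ 2x≤g+1 ∷ 2z≤g ∷ []
  Box-ineqs = 0≤x ∷ x≤g ∷ 0≤z ∷ z≤g ∷ []

-- Nested without a trailing ⊤, to match the conjunctions in Defs.
Region : List Form → ℤ → Pred (ℤ × ℤ) 0ℓ
Region []           g p = ⊤
Region (L ∷ [])     g p = Holds L g p
Region (L ∷ M ∷ Ls) g p = Holds L g p × Region (M ∷ Ls) g p

Region? : ∀ Ls g → Decidable (Region Ls g)
Region? []           g p = yes tt
Region? (L ∷ [])     g p = Holds? L
Region? (L ∷ M ∷ Ls) g p = Holds? L ×-dec Region? (M ∷ Ls) g p

Region-irrelevant : ∀ Ls g → Irrelevant (Region Ls g)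
Region-irrelevant []           g tt tt = refl
Region-irrelevant (L ∷ [])     g     = Holds-irrelevant
Region-irrelevant (L ∷ M ∷ Ls) g     = Holds-irrelevant ×-irrelevant Region-irrelevant (M ∷ Ls) g

-- The slack (right minus left side) of each inequality of Defs is the value of
-- its form, spelled out since the ring solver treats ⟦_⟧ as an atom.
module Slack where
  g≤3x+z   : ∀ g x z → + 3 * x + z - g ≡ + 0 + (- + 1 * g + + 3 * x + + 1 * z)
  g≤x+3z+1 : ∀ g x z → x + + 3 * z - (g - + 1) ≡ + 1 + (- + 1 * g + + 1 * x + + 3 * z)
  g≤x+z    : ∀ g x z → x + z - g ≡ + 0 + (- + 1 * g + + 1 * x + + 1 * z)
  2x≤g+1   : ∀ g x z → g + + 1 - + 2 * x ≡ + 1 + (+ 1 * g + - + 2 * x + + 0 * z)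
  2z≤g     : ∀ g x z → g - + 2 * z ≡ + 0 + (+ 1 * g + + 0 * x + - + 2 * z)
  8x≤2g+1  : ∀ g x z → + 2 * g + + 1 - + 8 * x ≡ + 1 + (+ 2 * g + - + 8 * x + + 0 * z)
  8z≤2g-3  : ∀ g x z → + 2 * g - + 3 - + 8 * z ≡ - + 3 + (+ 2 * g + + 0 * x + - + 8 * z)
  2g+1≤8x  : ∀ g x z → + 8 * x - (+ 2 * g + + 1) ≡ - + 1 + (- + 2 * g + + 8 * x + + 0 * z)
  2g-3≤8z  : ∀ g x z → + 8 * z - (+ 2 * g - + 3) ≡ + 3 + (- + 2 * g + + 0 * x + + 8 * z)
  0≤x      : ∀ g x z → x - + 0 ≡ + 0 + (+ 0 * g + + 1 * x + + 0 * z)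
  x≤g      : ∀ g x z → g - x ≡ + 0 + (+ 1 * g + - + 1 * x + + 0 * z)
  0≤z      : ∀ g x z → z - + 0 ≡ + 0 + (+ 0 * g + + 0 * x + + 1 * z)
  z≤g      : ∀ g x z → g - z ≡ + 0 + (+ 1 * g + + 0 * x + - + 1 * z)
  9≤g      : ∀ g x z → g - + 9 ≡ - + 9 + (+ 1 * g + + 0 * x + + 0 * z)
  g≤3x+z   = solve-∀
  g≤x+3z+1 = solve-∀
  g≤x+z    = solve-∀
  2x≤g+1   = solve-∀
  2z≤g     = solve-∀
  8x≤2g+1  = solve-∀
  8z≤2g-3  = solve-∀
  2g+1≤8x  = solve-∀
  2g-3≤8z  = solve-∀
  0≤x      = solve-∀
  x≤g      = solve-∀
  0≤z      = solve-∀
  z≤g      = solve-∀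
  9≤g      = solve-∀

TA⇔ : ∀ {g p} → TA g p ⇔ Region TA-ineqs g p
TA⇔ {g} {x , z} =
  ≤⇔Holds (Slack.g≤3x+z g x z) ×-⇔ ≤⇔Holds (Slack.8x≤2g+1 g x z) ×-⇔
  ≤⇔Holds (Slack.2z≤g g x z)

TB⇔ : ∀ {g p} → TB g p ⇔ Region TB-ineqs g p
TB⇔ {g} {x , z} =
  ≤⇔Holds (Slack.g≤x+3z+1 g x z) ×-⇔ ≤⇔Holds (Slack.2x≤g+1 g x z) ×-⇔
  ≤⇔Holds (Slack.8z≤2g-3 g x z)

RR⇔ : ∀ {g p} → RR g p ⇔ Region R-ineqs g p
RR⇔ {g} {x , z} =
  ≤⇔Holds (Slack.2g+1≤8x g x z) ×-⇔ ≤⇔Holds (Slack.2x≤g+1 g x z) ×-⇔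
  ≤⇔Holds (Slack.2g-3≤8z g x z) ×-⇔ ≤⇔Holds (Slack.2z≤g g x z)

TC⇔ : ∀ {g p} → TC g p ⇔ Region TC-ineqs g p
TC⇔ {g} {x , z} =
  ≤⇔Holds (Slack.g≤x+z g x z) ×-⇔ ≤⇔Holds (Slack.2x≤g+1 g x z) ×-⇔
  ≤⇔Holds (Slack.2z≤g g x z)

P4-on-plane⇔ : ∀ {g x z} → P4 g (x , g - x - z , z) ⇔ Region P-ineqs g (x , z)
P4-on-plane⇔ {g} {x} {z} =
  ≤⇔Holds (slack₁ g x z) ×-⇔ ≤⇔Holds (slack₂ g x z) ×-⇔ ≤⇔Holds (slack₃ g x z) ×-⇔
  ≤⇔Holds (slack₄ g x z) ×-⇔ drop-sum
    (≤⇔Holds (slack₆ g x z) ×-⇔ ≤⇔Holds (slack₇ g x z) ×-⇔ ≤⇔Holds (slack₈ g x z))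
  where
  slack₁ : ∀ g x z → + 2 * x - (g - x - z) - + 0 ≡ + 0 + (- + 1 * g + + 3 * x + + 1 * z)
  slack₂ : ∀ g x z → x + (g - x - z) - z - + 0 ≡ + 0 + (+ 1 * g + + 0 * x + - + 2 * z)
  slack₃ : ∀ g x z → - x + (g - x - z) + z - - + 1 ≡ + 1 + (+ 1 * g + - + 2 * x + + 0 * z)
  slack₄ : ∀ g x z → - (g - x - z) + + 2 * z - - + 1 ≡ + 1 + (- + 1 * g + + 1 * x + + 3 * z)
  slack₆ : ∀ g x z → x - + 1 ≡ - + 1 + (+ 0 * g + + 1 * x + + 0 * z)
  slack₇ : ∀ g x z → g - x - z - + 1 ≡ - + 1 + (+ 1 * g + - + 1 * x + - + 1 * z)
  slack₈ : ∀ g x z → z - + 1 ≡ - + 1 + (+ 0 * g + + 0 * x + + 1 * z)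
  sum    : ∀ g x z → x + (g - x - z) + z ≡ g
  slack₁ = solve-∀
  slack₂ = solve-∀
  slack₃ = solve-∀
  slack₄ = solve-∀
  slack₆ = solve-∀
  slack₇ = solve-∀
  slack₈ = solve-∀
  sum    = solve-∀
  drop-sum : ∀ {B C : Set} → B ⇔ C → (x + (g - x - z) + z ≡ g × B) ⇔ C
  drop-sum B⇔C = mk⇔ (Equivalence.to B⇔C ∘ proj₂) ((sum g x z ,_) ∘ Equivalence.from B⇔C)

TA-irrelevant : ∀ g → Irrelevant (TA g)
TA-irrelevant _ = ≤-irrelevant ×-irrelevant ≤-irrelevant ×-irrelevant ≤-irrelevant

TB-irrelevant : ∀ g → Irrelevant (TB g)
TB-irrelevant _ = ≤-irrelevant ×-irrelevant ≤-irrelevant ×-irrelevant ≤-irrelevant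

RR-irrelevant : ∀ g → Irrelevant (RR g)
RR-irrelevant _ = ≤-irrelevant ×-irrelevant ≤-irrelevant ×-irrelevant ≤-irrelevant ×-irrelevant ≤-irrelevant

TC-irrelevant : ∀ g → Irrelevant (TC g)
TC-irrelevant _ = ≤-irrelevant ×-irrelevant ≤-irrelevant ×-irrelevant ≤-irrelevant

P4-irrelevant : ∀ g → Irrelevant (P4 g)
P4-irrelevant _ = ≤-irrelevant ×-irrelevant ≤-irrelevant ×-irrelevant ≤-irrelevant ×-irrelevant
                ≤-irrelevant ×-irrelevant Decidable⇒UIP.≡-irrelevant _≟_ ×-irrelevant
                ≤-irrelevant ×-irrelevant ≤-irrelevant ×-irrelevant ≤-irrelevant

P4↔P-region : ∀ g → Σ (ℤ × ℤ × ℤ) (P4 g) ↔ Σ (ℤ × ℤ) (Region P-ineqs g)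
P4↔P-region g =
  Σ-⇔ (P4-irrelevant g) (Region-irrelevant P-ineqs g) P4-on-plane⇔
  ↔-∘ Σ-eliminate-middle (λ x z → g - x - z) (P4-irrelevant g) (λ (_ , _ , _ , _ , sum , _) → y≡ sum)
  where
  y≡ : ∀ {x y z} → x + y + z ≡ g → y ≡ g - x - z
  y≡ {x} {y} {z} refl = y≡x+y+z-x-z x y z
    where
    y≡x+y+z-x-z : ∀ x y z → y ≡ x + y + z - x - z
    y≡x+y+z-x-z = solve-∀

-- The decomposition

P⊆Box : ∀ {g} → Region P-ineqs g ⊆ Region Box-ineqs g
P⊆Box (_ , _ , _ , _ , 1≤x , x+z+1≤g , 1≤z) =
  cut 1 1≤x , cut 1 (x+z+1≤g ⊕ 1≤z) , cut 1 1≤z , cut 1 (x+z+1≤g ⊕ 1≤x)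

module Decomposition {g : ℤ} (g≥9 : + 9 ≤ g) where

  P Tᴬ Tᴮ R Tᶜ : Pred (ℤ × ℤ) 0ℓ
  P  = Region P-ineqs g
  Tᴬ = Region TA-ineqs g
  Tᴮ = Region TB-ineqs g
  R  = Region R-ineqs g
  Tᶜ = Region TC-ineqs g

  9≤g : ∀ {p} → Holds Ineq.9≤g g p
  9≤g {x , z} = Equivalence.to (≤⇔Holds (Slack.9≤g g x z)) g≥9

  P⊥Tᶜ : P ⊥ Tᶜ
  P⊥Tᶜ ((_ , _ , _ , _ , _ , x+z+1≤g , _) , (g≤x+z , _)) = 1≰0 (x+z+1≤g ⊕ g≤x+z)

  Tᴬ⊥Tᴮ∪R : Tᴬ ⊥ (Tᴮ ∪ R)
  Tᴬ⊥Tᴮ∪R ((g≤3x+z , 8x≤2g+1 , _) , inj₁ (_ , _ , 8z≤2g-3)) =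
    1≰0 (cut 1 (8 ⊛ g≤3x+z ⊕ 6 ⊛ cut 2 {Ineq.4x≤g} 8x≤2g+1 ⊕ 8z≤2g-3))
  Tᴬ⊥Tᴮ∪R ((_ , 8x≤2g+1 , _) , inj₂ (2g+1≤8x , _)) =
    1≰0 (2 ⊛ cut 2 {Ineq.4x≤g} 8x≤2g+1 ⊕ 2g+1≤8x)

  Tᴮ⊥R : Tᴮ ⊥ R
  Tᴮ⊥R ((_ , _ , 8z≤2g-3) , (_ , _ , 2g-3≤8z , _)) =
    1≰0 (2 ⊛ cut 2 {Ineq.4z+2≤g} 8z≤2g-3 ⊕ 2g-3≤8z)

  P⊆Tᴬ∪Tᴮ∪R : P ⊆ Tᴬ ∪ (Tᴮ ∪ R)
  P⊆Tᴬ∪Tᴮ∪R (g≤3x+z , 2z≤g , 2x≤g+1 , g≤x+3z+1 , _)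
    with Holds⊎Holds-complement Ineq.8x≤2g+1 | Holds⊎Holds-complement Ineq.8z≤2g-3
  ... | inj₁ 8x≤2g+1 | _            = inj₁ (g≤3x+z , 8x≤2g+1 , 2z≤g)
  ... | inj₂ _       | inj₁ 8z≤2g-3 = inj₂ (inj₁ (g≤x+3z+1 , 2x≤g+1 , 8z≤2g-3))
  ... | inj₂ 8x>2g+1 | inj₂ 8z>2g-3 = inj₂ (inj₂ (cut 1 8x>2g+1 , 2x≤g+1 , cut 1 8z>2g-3 , 2z≤g))

  Tᶜ⊆R : Tᶜ ⊆ R
  Tᶜ⊆R (g≤x+z , 2x≤g+1 , 2z≤g) =
    ( cut 1 (8 ⊛ g≤x+z ⊕ 4 ⊛ 2z≤g ⊕ 2 ⊛ 9≤g)
    , 2x≤g+1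
    , cut 1 (8 ⊛ g≤x+z ⊕ 4 ⊛ 2x≤g+1 ⊕ 2 ⊛ 9≤g)
    , 2z≤g )

  Tᴬ⊆P∪Tᶜ : Tᴬ ⊆ P ∪ Tᶜ
  Tᴬ⊆P∪Tᶜ (g≤3x+z , 8x≤2g+1 , 2z≤g) with Holds⊎Holds-complement Ineq.g≤x+z
  ... | inj₁ g≤x+z   = inj₂ (g≤x+z , cut 4 (8x≤2g+1 ⊕ 2 ⊛ 9≤g) , 2z≤g)
  ... | inj₂ x+z+1≤g = inj₁
    ( g≤3x+z
    , 2z≤g
    , cut 4 (8x≤2g+1 ⊕ 2 ⊛ 9≤g)
    , 3 ⊛ g≤3x+z ⊕ 8x≤2g+1
    , cut 6 (2 ⊛ g≤3x+z ⊕ 2z≤g ⊕ 9≤g)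
    , x+z+1≤g
    , cut 8 (8 ⊛ g≤3x+z ⊕ 3 ⊛ 8x≤2g+1 ⊕ 2 ⊛ 9≤g) )

  Tᴮ⊆P∪Tᶜ : Tᴮ ⊆ P ∪ Tᶜ
  Tᴮ⊆P∪Tᶜ (g≤x+3z+1 , 2x≤g+1 , 8z≤2g-3) with Holds⊎Holds-complement Ineq.g≤x+z
  ... | inj₁ g≤x+z   = inj₂ (g≤x+z , 2x≤g+1 , cut 4 (8z≤2g-3 ⊕ 2 ⊛ 9≤g))
  ... | inj₂ x+z+1≤g = inj₁
    ( 3 ⊛ g≤x+3z+1 ⊕ 8z≤2g-3
    , cut 4 (8z≤2g-3 ⊕ 2 ⊛ 9≤g)
    , 2x≤g+1
    , g≤x+3z+1
    , cut 8 (8 ⊛ g≤x+3z+1 ⊕ 3 ⊛ 8z≤2g-3 ⊕ 2 ⊛ 9≤g)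
    , x+z+1≤g
    , cut 6 (2 ⊛ g≤x+3z+1 ⊕ 2x≤g+1 ⊕ 9≤g) )

  R⊆P∪Tᶜ : R ⊆ P ∪ Tᶜ
  R⊆P∪Tᶜ (2g+1≤8x , 2x≤g+1 , 2g-3≤8z , 2z≤g) with Holds⊎Holds-complement Ineq.g≤x+z
  ... | inj₁ g≤x+z   = inj₂ (g≤x+z , 2x≤g+1 , 2z≤g)
  ... | inj₂ x+z+1≤g = inj₁
    ( cut 8 (3 ⊛ 2g+1≤8x ⊕ 2g-3≤8z)
    , 2z≤g
    , 2x≤g+1
    , cut 8 (2g+1≤8x ⊕ 3 ⊛ 2g-3≤8z)
    , cut 8 (2g+1≤8x ⊕ 2 ⊛ 9≤g)
    , x+z+1≤g
    , cut 8 (2g-3≤8z ⊕ 2 ⊛ 9≤g) )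

  Tᶜ⊆Box : Tᶜ ⊆ Region Box-ineqs g
  Tᶜ⊆Box (g≤x+z , 2x≤g+1 , 2z≤g) =
    cut 2 (2 ⊛ g≤x+z ⊕ 2z≤g ⊕ 9≤g) , cut 2 (2x≤g+1 ⊕ 9≤g) ,
    cut 2 (2 ⊛ g≤x+z ⊕ 2x≤g+1 ⊕ 9≤g) , cut 2 (2z≤g ⊕ 9≤g)

  P∪Tᶜ≐Tᴬ∪Tᴮ∪R : P ∪ Tᶜ ≐ Tᴬ ∪ (Tᴮ ∪ R)
  P∪Tᶜ≐Tᴬ∪Tᴮ∪R = to , from
    where
    to : P ∪ Tᶜ ⊆ Tᴬ ∪ (Tᴮ ∪ R)
    to (inj₁ p) = P⊆Tᴬ∪Tᴮ∪R p
    to (inj₂ c) = inj₂ (inj₂ (Tᶜ⊆R c))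
    from : Tᴬ ∪ (Tᴮ ∪ R) ⊆ P ∪ Tᶜ
    from (inj₁ a)        = Tᴬ⊆P∪Tᶜ a
    from (inj₂ (inj₁ b)) = Tᴮ⊆P∪Tᶜ b
    from (inj₂ (inj₂ r)) = R⊆P∪Tᶜ r

  P∪Tᶜ⊆Box : P ∪ Tᶜ ⊆ Region Box-ineqs g
  P∪Tᶜ⊆Box (inj₁ p) = P⊆Box p
  P∪Tᶜ⊆Box (inj₂ c) = Tᶜ⊆Box c

-- Counting in the box [0, g]²

range : ℕ → List ℤ
range n = map +_ (upTo (ℕ.suc n))

box : ℕ → List (ℤ × ℤ)
box n = cartesianProduct (range n) (range n)

box-unique : ∀ n → Unique (box n)
box-unique n = cartesianProduct⁺ range-unique range-unique
  where range-unique = map⁺ +-injective (upTo⁺ (ℕ.suc n))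

Box⊆box : ∀ {n} → Region Box-ineqs (+ n) ⊆ (_∈ box n)
Box⊆box {n} {x , z} (0≤x , x≤g , 0≤z , z≤g) =
  ∈-cartesianProduct⁺ (in-range (≤-from (Slack.0≤x (+ n) x z) 0≤x) (≤-from (Slack.x≤g (+ n) x z) x≤g))
                      (in-range (≤-from (Slack.0≤z (+ n) x z) 0≤z) (≤-from (Slack.z≤g (+ n) x z) z≤g))
  where
  ≤-from : ∀ {L a b} → b - a ≡ ⟦ L ⟧ (+ n) (x , z) → Holds L (+ n) (x , z) → a ≤ b
  ≤-from slack = Equivalence.from (≤⇔Holds slack)
  in-range : ∀ {i} → + 0 ≤ i → i ≤ + n → i ∈ range n
  in-range {+ k} _ (+≤+ k≤n) = ∈-map⁺ +_ (∈-upTo⁺ (s≤s k≤n))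

count : List Form → ℕ → ℕ
count Ls n = length (filter (Region? Ls (+ n)) (box n))

HasCard-Region : ∀ Ls n {S : Pred (ℤ × ℤ) 0ℓ} → Irrelevant S → (∀ {p} → S p ⇔ Region Ls (+ n) p) →
                 Region Ls (+ n) ⊆ Region Box-ineqs (+ n) → HasCard S (count Ls n)
HasCard-Region Ls n S-irr S⇔Region ⊆Box =
  HasCard-↔ (↔-sym (Σ-⇔ S-irr (Region-irrelevant Ls (+ n)) S⇔Region))
    (HasCard-filter (Decidable⇒UIP.≡-irrelevant (≡-dec _≟_ _≟_)) (Region? Ls (+ n))
                    (Region-irrelevant Ls (+ n)) (box-unique n) (Box⊆box ∘ ⊆Box))

HasCard-P4 : ∀ n → HasCard (P4 (+ n)) (count P-ineqs n)
HasCard-P4 n = HasCard-↔ (↔-sym (P4↔P-region (+ n)))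
  (HasCard-Region P-ineqs n (Region-irrelevant P-ineqs (+ n)) (⇔-id _) P⊆Box)

module Cardinalities {n : ℕ} (n≥9 : + 9 ≤ + n) where
  open Decomposition n≥9

  HasCard-TA : HasCard (TA (+ n)) (count TA-ineqs n)
  HasCard-TA = HasCard-Region TA-ineqs n (TA-irrelevant (+ n)) TA⇔ (P∪Tᶜ⊆Box ∘ Tᴬ⊆P∪Tᶜ)

  HasCard-TB : HasCard (TB (+ n)) (count TB-ineqs n)
  HasCard-TB = HasCard-Region TB-ineqs n (TB-irrelevant (+ n)) TB⇔ (P∪Tᶜ⊆Box ∘ Tᴮ⊆P∪Tᶜ)

  HasCard-RR : HasCard (RR (+ n)) (count R-ineqs n)
  HasCard-RR = HasCard-Region R-ineqs n (RR-irrelevant (+ n)) RR⇔ (P∪Tᶜ⊆Box ∘ R⊆P∪Tᶜ)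

  HasCard-TC : HasCard (TC (+ n)) (count TC-ineqs n)
  HasCard-TC = HasCard-Region TC-ineqs n (TC-irrelevant (+ n)) TC⇔ (P∪Tᶜ⊆Box ∘ inj₂)

  count-identity : count P-ineqs n ℕ.+ count TC-ineqs n ≡
                   count TA-ineqs n ℕ.+ count TB-ineqs n ℕ.+ count R-ineqs n
  count-identity = begin
    count P-ineqs n ℕ.+ count TC-ineqs n
      ≡⟨ length-filter-∪ P? C? P⊥Tᶜ (box n) ⟨
    length (filter (P? ∪? C?) (box n))
      ≡⟨ cong length (filter-≐ (P? ∪? C?) (A? ∪? (B? ∪? R?)) P∪Tᶜ≐Tᴬ∪Tᴮ∪R (box n)) ⟩
    length (filter (A? ∪? (B? ∪? R?)) (box n))
      ≡⟨ length-filter-∪ A? (B? ∪? R?) Tᴬ⊥Tᴮ∪R (box n) ⟩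
    count TA-ineqs n ℕ.+ length (filter (B? ∪? R?) (box n))
      ≡⟨ cong (count TA-ineqs n ℕ.+_) (length-filter-∪ B? R? Tᴮ⊥R (box n)) ⟩
    count TA-ineqs n ℕ.+ (count TB-ineqs n ℕ.+ count R-ineqs n)
      ≡⟨ +-assoc (count TA-ineqs n) _ _ ⟨
    count TA-ineqs n ℕ.+ count TB-ineqs n ℕ.+ count R-ineqs n
      ∎
    where
    open ≡-Reasoning
    P? = Region? P-ineqs (+ n)
    A? = Region? TA-ineqs (+ n)
    B? = Region? TB-ineqs (+ n)
    R? = Region? R-ineqs (+ n)
    C? = Region? TC-ineqs (+ n)

mainTheorem6 : (HasCard (P4 (+ 3)) 1 × HasCard (P4 (+ 4)) 3 × HasCard (P4 (+ 5)) 4 ×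
                HasCard (P4 (+ 6)) 6 × HasCard (P4 (+ 7)) 7 × HasCard (P4 (+ 8)) 9)
               ×
               ((g : ℤ) → + 9 ≤ g →
                 Σ ℕ λ nP → Σ ℕ λ nA → Σ ℕ λ nB → Σ ℕ λ nR → Σ ℕ λ nC →
                   HasCard (P4 g) nP × HasCard (TA g) nA × HasCard (TB g) nB ×
                   HasCard (RR g) nR × HasCard (TC g) nC ×
                   (nP ℕ.+ nC ≡ nA ℕ.+ nB ℕ.+ nR))
mainTheorem6 =
  (HasCard-P4 3 , HasCard-P4 4 , HasCard-P4 5 , HasCard-P4 6 , HasCard-P4 7 , HasCard-P4 8) ,
  λ { (+ n) g≥9 → let open Cardinalities g≥9 in
        _ , _ , _ , _ , _ , HasCard-P4 n , HasCard-TA , HasCard-TB , HasCard-RR , HasCard-TC , count-identity }
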